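{- Let $n\ge 1$ and let $F=[\ell_1,\ell_2,\ldots,\ell_s]$ be a $2$-regular graph of order $2n+1$ (with cycles of lengths $\ell_1,\dots,\ell_s$) satisfying: (1) $V(F)=\mathbb{Z}_{2n}\cup\{\infty\}$; (2) $\Delta F\supseteq \mathbb{Z}_{2n}\setminus\{0\}$; (3) $F+n=F$. If $C$ is an $\ell_1$-cycle of $F$ such that $\Delta C$ contains an element of $\mathbb{Z}_{2n}$ whose additive order is congruent to $2 \pmod 4$, then there exists a solution to $OP([\ell_1+1,\ell_2,\ldots,\ell_s])$.
   Context: For $v\ge 3$, let $K_v^*$ denote the complete graph $K_v$ if $v$ is odd, and $K_v$ minus a $1$-factor (perfect matching) if $v$ is even. A $2$-factor is a spanning $2$-regular subgraph; $[\ell_1,\dots,\ell_s]$ denotes a $2$-regular graph that is a disjoint union of cycles of lengths $\ell_1,\dots,\ell_s$. For a $2$-regular graph $F$ of order $v$, the Oberwolfach problem $OP(F)$ asks for a $2$-factorization of $K_v^*$ (a decomposition of its edge set into edge-disjoint $2$-factors) in which every $2$-factor is isomorphic to $F$; such a decomposition is called a solution to $OP(F)$. For a graph $\Gamma$ with vertices in $\mathbb{Z}_{2n}\cup\{\infty\}$, $\Delta\Gamma$ is the multiset of all differences $x-y \in \mathbb{Z}_{2n}$ over all ordered pairs $(x,y)$ of adjacent vertices of $\Gamma$ with $x,y\neq\infty$ (so each such edge contributes both $x-y$ and $y-x$). For $g\in\mathbb{Z}_{2n}$, $\Gamma+g$ is the graph obtained from $\Gamma$ by replacing each vertex $x\neq\infty$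 with $x+g$ (and fixing $\infty$). -}

module Defs where

open import Data.Nat using (ℕ; zero; suc; _+_; _*_; _∸_; _≤_; _<_)
import Data.Nat.Properties
open import Data.Nat.DivMod using (_%_; m%n<n)
open import Data.Nat.Divisibility using (_∣_)
open import Data.Fin using (Fin; toℕ; fromℕ<; _≟_)
open import Data.Maybe using (Maybe; just; nothing)
open import Data.List using (List; []; _∷_; _++_; map; concat; concatMap; length; allFin; zip)
open import Data.Nat.ListAction using (sum)
open import Data.List.Membership.Propositional using (_∈_)
open import Data.List.Relation.Binary.Permutation.Propositional using (_↭_)
open import Data.List.Relation.Unary.All using (All)
open import Data.Product using (Σ; ∃; ∃-syntax; _×_; _,_)
open import Data.Sum using (_⊎_)
open import Data.Bool using (true; false; _∧_; if_then_else_)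
open import Relation.Nullary using (¬_; does)
open import Relation.Binary.PropositionalEquality using (_≡_; _≢_)

addMod : ∀ {m} → Fin m → Fin m → Fin m
addMod {suc m} x y = fromℕ< (m%n<n (toℕ x + toℕ y) (suc m))

negMod : ∀ {m} → Fin m → Fin m
negMod {suc m} x = fromℕ< (m%n<n (suc m ∸ toℕ x) (suc m))

subMod : ∀ {m} → Fin m → Fin m → Fin m
subMod x y = addMod x (negMod y)

IsAddOrder : (m : ℕ) → Fin m → ℕ → Set
IsAddOrder m d k =
  1 ≤ k × m ∣ k * toℕ d × (∀ j → 1 ≤ j → j < k → ¬ (m ∣ j * toℕ d))

-- Cycles and 2-regular graphs given as lists of cycles.
-- A cycle is the list of its vertices in cyclic order [a1,...,ak];
-- its edges are (a1,a2),...,(a(k-1),ak),(ak,a1).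

rotate : ∀ {A : Set} → List A → List A
rotate []       = []
rotate (a ∷ as) = as ++ (a ∷ [])

cycleEdges : ∀ {A : Set} → List A → List (A × A)
cycleEdges c = zip c (rotate c)

graphEdges : ∀ {A : Set} → List (List A) → List (A × A)
graphEdges = concatMap cycleEdges

Adj : ∀ {A : Set} → List (List A) → A → A → Set
Adj G x y = (x , y) ∈ graphEdges G ⊎ (y , x) ∈ graphEdges G

IsTwoRegularOn : ∀ {A : Set} → List A → List (List A) → Set
IsTwoRegularOn vs G = All (λ c → 3 ≤ length c) G × concat G ↭ vs

-- Vertex set ℤ_m ∪ {∞}; ∞ is `nothing`.

V∞ : ℕ → Set
V∞ m = Maybe (Fin m)

allV∞ : (m : ℕ) → List (V∞ m)
allV∞ m = nothing ∷ map just (allFin m)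

shiftV : ∀ {m} → Fin m → V∞ m → V∞ m
shiftV g nothing  = nothing
shiftV g (just x) = just (addMod x g)

translate : ∀ {m} → List (List (V∞ m)) → Fin m → List (List (V∞ m))
translate G g = map (map (shiftV g)) G

diffsOfEdges : ∀ {m} → List (V∞ m × V∞ m) → List (Fin m)
diffsOfEdges [] = []
diffsOfEdges ((just x , just y) ∷ es) = subMod x y ∷ subMod y x ∷ diffsOfEdges es
diffsOfEdges ((just x , nothing) ∷ es) = diffsOfEdges es
diffsOfEdges ((nothing , y) ∷ es) = diffsOfEdges es

Δ : ∀ {m} → List (List (V∞ m)) → List (Fin m)
Δ G = diffsOfEdges (graphEdges G)

occ : ∀ {v} → Fin v → Fin v → List (Fin v × Fin v) → ℕ
occ x y [] = 0
occ x y ((a , b) ∷ es) =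
  if does (a ≟ x) ∧ does (b ≟ y) then suc (occ x y es) else occ x y es

-- perfect matching on Fin v as a fixed-point-free involution
IsPerfectMatching : ∀ {v} → (Fin v → Fin v) → Set
IsPerfectMatching M = (∀ x → M x ≢ x) × (∀ x → M (M x) ≡ x)

-- adj is the adjacency relation of K_v^*
IsKStar : (v : ℕ) → (Fin v → Fin v → Set) → Set
IsKStar v adj =
    (v % 2 ≡ 1 × (∀ x y → (adj x y → x ≢ y) × (x ≢ y → adj x y)))
  ⊎ (v % 2 ≡ 0 × Σ (Fin v → Fin v) λ M → IsPerfectMatching M ×
       (∀ x y → (adj x y → x ≢ y × y ≢ M x) × (x ≢ y × y ≢ M x → adj x y)))

-- a 2-factor of K_v^* isomorphic to [ℓ1,...,ℓs]: a 2-regular spanning graph on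
-- Fin v whose multiset of cycle lengths is L
IsTwoFactorOfType : (v : ℕ) → List ℕ → List (List (Fin v)) → Set
IsTwoFactorOfType v L f = IsTwoRegularOn (allFin v) f × map length f ↭ L

-- a solution to OP([ℓ1,...,ℓs]) for L = ℓ1 ∷ ... ∷ ℓs, of order v = ℓ1+...+ℓs:
-- a list of 2-factors, each isomorphic to [ℓ1,...,ℓs], decomposing the edge set
-- of K_v^* (every factor edge is an edge of K_v^*; every edge of K_v^* occurs
-- exactly once among all factors)
OPSolution : List ℕ → Set₁
OPSolution L =
  Σ (Fin (sum L) → Fin (sum L) → Set) λ adj → IsKStar (sum L) adj ×
  Σ (List (List (List (Fin (sum L))))) λ fs →
      All (IsTwoFactorOfType (sum L) L) fs
    × All (λ e → adj (Data.Product.proj₁ e) (Data.Product.proj₂ e)) (concatMap graphEdges fs)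
    × (∀ x y → adj x y → occ x y (concatMap graphEdges fs) + occ y x (concatMap graphEdges fs) ≡ 1)

OP : List ℕ → Set₁
OP L = OPSolution L

-- the element n of ℤ_{2n} (n ≥ 1)
halfElem : (n : ℕ) → 1 ≤ n → Fin (2 * n)
halfElem n p = fromℕ< (Data.Nat.Properties.m<m+n n {n Data.Nat.+ 0} (Data.Nat.Properties.≤-trans p (Data.Nat.Properties.m≤m+n n 0)))

{-# OPTIONS --safe #-}
-- Let d ∈ ΔC have additive order 2h with h odd. Then 2n = 2h·g and d is an odd multiple of g, so
-- adding d, and likewise adding n = h·g, flips the block parity ⌊z / g⌋ mod 2 on ℤ_2n. Insert a
-- new vertex ∞′ into an edge {p, q} of C with q - p = ±d and take the translates of this 2-factor
-- by the n elements of even block parity. They cover every edge of K_{2n+2} except the perfect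
-- matching formed by {∞, ∞′} and the pairs {z, z + (q - p)} with z - p of even block parity: a pair
-- {z₁, z₂} is a translate of an F-edge with difference z₁ - z₂ by some t, which can be taken even
-- because F + n = F, and it is missed only if that edge is {p, q}, i.e. if the pair is a matching
-- edge. Every factor gives each vertex degree 2 and K_{2n+2} minus the matching is 2n-regular, so
-- this covering is a 2-factorization.
module Submission where

open import Defs
open import Data.Nat using (ℕ; suc; _+_; _*_; _≤_; _%_)
open import Data.Fin using (Fin; toℕ)
open import Data.List using (List; []; _∷_; map; length)
open import Data.List.Membership.Propositional using (_∈_)
open import Data.Product using (Σ; _×_; ∃-syntax)
open import Relation.Binary.PropositionalEquality using (_≡_; _≢_)

open import Level using (0ℓ)
open import Algebra.Bundles using (AbelianGroup)
open import Algebra.Structures using (IsCommutativeMonoid)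
open import Algebra.Structures.Biased using (IsCommutativeMonoidʳ)
import Algebra.Properties.AbelianGroup as AbelianGroupProperties
import Algebra.Properties.CommutativeSemigroup as CommutativeSemigroupProperties
open import Data.Nat using (zero; pred; _∸_; _<_; z≤n; s≤s; z<s; NonZero; _<?_; >-nonZero⁻¹; ≢-nonZero⁻¹)
open import Data.Nat.Properties hiding (_≟_)
open import Data.Nat.DivMod
open import Data.Nat.Divisibility using (_∣_; divides; ∣m+n∣m⇒∣n; n∣m*n; ∣-trans)
open import Data.Nat.Tactic.RingSolver using (solve-∀)
open import Data.Nat.ListAction using (sum)
open import Data.Nat.ListAction.Properties using (sum-++; sum-↭)
open import Data.Bool using (true; false; _∧_; if_then_else_)
open import Data.Bool.Properties using (∧-zeroʳ; ∧-identityʳ)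
open import Data.Fin using (fromℕ<; _↑ˡ_; _≟_) renaming (zero to fzero; suc to fsuc)
open import Data.Fin.Properties using (toℕ-fromℕ<; toℕ-injective; toℕ<n; toℕ-↑ˡ) renaming (suc-injective to fsuc-injective)
open import Data.Maybe using (just; nothing)
import Data.Maybe.Properties as Maybe
import Data.Product as Product
open import Data.Product using (_,_; proj₁; proj₂)
open import Data.Sum using (_⊎_; inj₁; inj₂)
import Data.Sum as Sum
open import Data.List using (_++_; concat; concatMap; allFin; zip; [_])
open import Data.List.Properties using (map-++; map-tabulate; map-cong; map-∘; zip-map; length-++; length-map; length-tabulate; concat-map; ++-identityʳ)
open import Data.List.Membership.Propositional.Properties using (∈-∃++; ∈-map⁻; ∈-map⁺; ∈-++⁺ˡ; ∈-++⁺ʳ; ∈-++⁻; ∈-concat⁻′; ∈-concat⁺′; ∈-allFin)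
open import Data.List.Relation.Unary.Any using (here; there)
open import Data.List.Relation.Unary.All as All using (All; []; _∷_)
import Data.List.Relation.Unary.All.Properties as All
open import Data.List.Relation.Binary.Permutation.Propositional using (_↭_; prep; swap; ↭-sym; ↭-trans; ↭-refl; ↭-reflexive)
open import Data.List.Relation.Binary.Permutation.Propositional.Properties using (shift; map⁺; ∷↭∷ʳ; ++⁺; ++⁺ʳ; ∈-resp-↭; ↭-length)
open import Data.Empty using (⊥-elim)
open import Function using (_∘′_)
open import Relation.Nullary using (¬_; Dec; does; yes; no)
open import Relation.Binary.Definitions using (DecidableEquality)
open import Relation.Binary.PropositionalEquality using (refl; sym; trans; cong; cong₂; subst; subst₂; isEquivalence; module ≡-Reasoning)
open ≡-Reasoning

-- ℤ_m as an abelian group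

[m%o+n]%o≡[m+n]%o : ∀ m n o .{{_ : NonZero o}} → (m % o + n) % o ≡ (m + n) % o
[m%o+n]%o≡[m+n]%o m n o = begin
  (m % o + n) % o         ≡⟨ %-distribˡ-+ (m % o) n o ⟩
  (m % o % o + n % o) % o ≡⟨ cong (λ x → (x + n % o) % o) (m%n%n≡m%n m o) ⟩
  (m % o + n % o) % o     ≡⟨ %-distribˡ-+ m n o ⟨
  (m + n) % o             ∎

[m+n%o]%o≡[m+n]%o : ∀ m n o .{{_ : NonZero o}} → (m + n % o) % o ≡ (m + n) % o
[m+n%o]%o≡[m+n]%o m n o = begin
  (m + n % o) % o ≡⟨ cong (_% o) (+-comm m (n % o)) ⟩
  (n % o + m) % o ≡⟨ [m%o+n]%o≡[m+n]%o n m o ⟩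
  (n + m) % o     ≡⟨ cong (_% o) (+-comm n m) ⟩
  (m + n) % o     ∎

module _ {k : ℕ} where

  toℕ-addMod : (x y : Fin (suc k)) → toℕ (addMod x y) ≡ (toℕ x + toℕ y) % suc k
  toℕ-addMod x y = toℕ-fromℕ< _

  toℕ-negMod : (x : Fin (suc k)) → toℕ (negMod x) ≡ (suc k ∸ toℕ x) % suc k
  toℕ-negMod x = toℕ-fromℕ< _

  addMod-comm : (x y : Fin (suc k)) → addMod x y ≡ addMod y x
  addMod-comm x y = toℕ-injective (begin
    toℕ (addMod x y)        ≡⟨ toℕ-addMod x y ⟩
    (toℕ x + toℕ y) % suc k ≡⟨ cong (_% suc k) (+-comm (toℕ x) (toℕ y)) ⟩
    (toℕ y + toℕ x) % suc k ≡⟨ toℕ-addMod y x ⟨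
    toℕ (addMod y x)        ∎)

  addMod-assoc : (x y z : Fin (suc k)) → addMod (addMod x y) z ≡ addMod x (addMod y z)
  addMod-assoc x y z = toℕ-injective (begin
    toℕ (addMod (addMod x y) z)                 ≡⟨ toℕ-addMod (addMod x y) z ⟩
    (toℕ (addMod x y) + toℕ z) % suc k          ≡⟨ cong (λ w → (w + toℕ z) % suc k) (toℕ-addMod x y) ⟩
    ((toℕ x + toℕ y) % suc k + toℕ z) % suc k   ≡⟨ [m%o+n]%o≡[m+n]%o (toℕ x + toℕ y) (toℕ z) (suc k) ⟩
    (toℕ x + toℕ y + toℕ z) % suc k             ≡⟨ cong (_% suc k) (+-assoc (toℕ x) (toℕ y) (toℕ z)) ⟩
    (toℕ x + (toℕ y + toℕ z)) % suc k           ≡⟨ [m+n%o]%o≡[m+n]%o (toℕ x) (toℕ y + toℕ z) (suc k) ⟨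
    (toℕ x + (toℕ y + toℕ z) % suc k) % suc k   ≡⟨ cong (λ w → (toℕ x + w) % suc k) (toℕ-addMod y z) ⟨
    (toℕ x + toℕ (addMod y z)) % suc k          ≡⟨ toℕ-addMod x (addMod y z) ⟨
    toℕ (addMod x (addMod y z))                 ∎)

  addMod-identityʳ : (x : Fin (suc k)) → addMod x fzero ≡ x
  addMod-identityʳ x = toℕ-injective (begin
    toℕ (addMod x fzero)  ≡⟨ toℕ-addMod x fzero ⟩
    (toℕ x + 0) % suc k   ≡⟨ cong (_% suc k) (+-identityʳ (toℕ x)) ⟩
    toℕ x % suc k         ≡⟨ m<n⇒m%n≡m (toℕ<n x) ⟩
    toℕ x                 ∎)

  addMod-inverseʳ : (x : Fin (suc k)) → addMod x (negMod x) ≡ fzero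
  addMod-inverseʳ x = toℕ-injective (begin
    toℕ (addMod x (negMod x))                ≡⟨ toℕ-addMod x (negMod x) ⟩
    (toℕ x + toℕ (negMod x)) % suc k         ≡⟨ cong (λ w → (toℕ x + w) % suc k) (toℕ-negMod x) ⟩
    (toℕ x + (suc k ∸ toℕ x) % suc k) % suc k ≡⟨ [m+n%o]%o≡[m+n]%o (toℕ x) (suc k ∸ toℕ x) (suc k) ⟩
    (toℕ x + (suc k ∸ toℕ x)) % suc k        ≡⟨ cong (_% suc k) (m+[n∸m]≡n (<⇒≤ (toℕ<n x))) ⟩
    suc k % suc k                            ≡⟨ n%n≡0 (suc k) ⟩
    0                                        ∎)

ℤ-mod-abelianGroup : ℕ → AbelianGroup 0ℓ 0ℓ
ℤ-mod-abelianGroup k = record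
  { Carrier = Fin (suc k)
  ; _≈_ = _≡_
  ; _∙_ = addMod
  ; ε = fzero
  ; _⁻¹ = negMod
  ; isAbelianGroup = record
    { isGroup = record
      { isMonoid = IsCommutativeMonoid.isMonoid isCommutativeMonoid
      ; inverse = (λ x → trans (addMod-comm (negMod x) x) (addMod-inverseʳ x)) , addMod-inverseʳ
      ; ⁻¹-cong = cong negMod
      }
    ; comm = addMod-comm
    }
  }
  where
  isCommutativeMonoid : IsCommutativeMonoid {A = Fin (suc k)} _≡_ addMod fzero
  isCommutativeMonoid = IsCommutativeMonoidʳ.isCommutativeMonoid (record
    { isSemigroup = record { isMagma = record { isEquivalence = isEquivalence ; ∙-cong = cong₂ addMod } ; assoc = addMod-assoc }
    ; identityʳ = addMod-identityʳ
    ; comm = addMod-comm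
    })

module _ {a ℓ} (G : AbelianGroup a ℓ) where
  open AbelianGroup G renaming (trans to ≈-trans; sym to ≈-sym)
  open AbelianGroupProperties G
  open CommutativeSemigroupProperties commutativeSemigroup

  x∙[y-x]≈y : ∀ x y → x ∙ (y - x) ≈ y
  x∙[y-x]≈y x y = ≈-trans (comm x (y - x)) (//-rightDividesˡ x y)

  [x∙y]-x≈y : ∀ x y → x ∙ y - x ≈ y
  [x∙y]-x≈y x y = ≈-trans (∙-congʳ (comm x y)) (//-rightDividesʳ x y)

  x∙[y-z]≈[x-z]∙y : ∀ x y z → x ∙ (y - z) ≈ (x - z) ∙ y
  x∙[y-z]≈[x-z]∙y x y z = x∙yz≈xz∙y x y (z ⁻¹)

  [x∙y]-z≈[x-z]∙y : ∀ x y z → x ∙ y - z ≈ (x - z) ∙ y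
  [x∙y]-z≈[x-z]∙y x y z = xy∙z≈xz∙y x y (z ⁻¹)

  [x-y]∙[y-z]≈x-z : ∀ x y z → (x - y) ∙ (y - z) ≈ x - z
  [x-y]∙[y-z]≈x-z x y z = ≈-trans (≈-sym (assoc (x - y) y (z ⁻¹))) (∙-congʳ (//-rightDividesˡ y x))

-- Additive orders and odd multiples

IsOddMultiple : ℕ → ℕ → Set
IsOddMultiple g x = ∃[ o ] x ≡ o * g × o % 2 ≡ 1

m%2≡0⊎m%2≡1 : ∀ m → m % 2 ≡ 0 ⊎ m % 2 ≡ 1
m%2≡0⊎m%2≡1 m with m % 2 | m%n<n m 2
... | 0 | _ = inj₁ refl
... | 1 | _ = inj₂ refl
... | suc (suc _) | s≤s (s≤s ())

m%4≡2⇒m≡2*odd : ∀ m → m % 4 ≡ 2 → ∃[ h ] m ≡ 2 * h × h % 2 ≡ 1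
m%4≡2⇒m≡2*odd m m%4≡2 = 1 + m / 4 * 2 , m≡2h , [m+kn]%n≡m%n 1 (m / 4) 2
  where
  m≡2h : m ≡ 2 * (1 + m / 4 * 2)
  m≡2h = begin
    m                     ≡⟨ m≡m%n+[m/n]*n m 4 ⟩
    m % 4 + m / 4 * 4     ≡⟨ cong (_+ m / 4 * 4) m%4≡2 ⟩
    2 + m / 4 * 4         ≡⟨ lemma (m / 4) ⟩
    2 * (1 + m / 4 * 2)   ∎
    where lemma : ∀ a → 2 + a * 4 ≡ 2 * (1 + a * 2)
          lemma = solve-∀

module _ {m : ℕ} .{{_ : NonZero m}} {d : Fin m} where

  addOrder∣modulus : ∀ {k} → IsAddOrder m d k → k ∣ m
  addOrder∣modulus {suc k} (_ , divides c kd≡cm , minimal) = divides (m / suc k) m≡qk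
    where
    r = m % suc k
    q = m / suc k
    m≡r+qk : m ≡ r + q * suc k
    m≡r+qk = m≡m%n+[m/n]*n m (suc k)
    m∣rd : m ∣ r * toℕ d
    m∣rd = ∣m+n∣m⇒∣n (divides (toℕ d) (begin
        q * (suc k * toℕ d) + r * toℕ d ≡⟨ lemma r q (suc k) (toℕ d) ⟩
        (r + q * suc k) * toℕ d         ≡⟨ cong (_* toℕ d) m≡r+qk ⟨
        m * toℕ d                       ≡⟨ *-comm m (toℕ d) ⟩
        toℕ d * m                       ∎))
      (∣-trans (divides c kd≡cm) (n∣m*n q))
      where lemma : ∀ r q k d → q * (k * d) + r * d ≡ (r + q * k) * d
            lemma = solve-∀
    r≡0 : r ≡ 0
    r≡0 with r in r≡ | m%n<n m (suc k)
    ... | zero  | _   = refl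
    ... | suc _ | r<k = ⊥-elim (minimal _ (s≤s z≤n) r<k (subst (λ x → m ∣ x * toℕ d) r≡ m∣rd))
    m≡qk : m ≡ q * suc k
    m≡qk = trans m≡r+qk (cong (_+ q * suc k) r≡0)

  -- If c were even, h d = (c / 2) m would contradict the minimality of the order 2h.
  addOrder≡2h⇒oddMultiple : ∀ {h} → IsAddOrder m d (2 * h) →
                            ∃[ g ] m ≡ 2 * h * g × IsOddMultiple g (toℕ d)
  addOrder≡2h⇒oddMultiple {suc h} order@(_ , divides c 2hd≡cm , minimal) with addOrder∣modulus order
  ... | divides g m≡g2h = g , trans m≡g2h (*-comm g (2 * suc h)) , c , d≡cg , c-odd
    where
    d≡cg : toℕ d ≡ c * g
    d≡cg = *-cancelˡ-≡ (toℕ d) (c * g) (2 * suc h) (begin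
      2 * suc h * toℕ d     ≡⟨ 2hd≡cm ⟩
      c * m                 ≡⟨ cong (c *_) m≡g2h ⟩
      c * (g * (2 * suc h)) ≡⟨ lemma c g (2 * suc h) ⟩
      2 * suc h * (c * g)   ∎)
      where lemma : ∀ c g k → c * (g * k) ≡ k * (c * g)
            lemma = solve-∀
    c-odd : c % 2 ≡ 1
    c-odd with m%2≡0⊎m%2≡1 c
    ... | inj₂ c%2≡1 = c%2≡1
    ... | inj₁ c%2≡0 = ⊥-elim (minimal (suc h) (s≤s z≤n) (m<m+n (suc h) z<s) (divides (c / 2) (begin
      suc h * toℕ d                   ≡⟨ cong (suc h *_) d≡cg ⟩
      suc h * (c * g)                 ≡⟨ cong (λ x → suc h * (x * g)) c≡c/2*2 ⟩
      suc h * (c / 2 * 2 * g)         ≡⟨ lemma (suc h) (c / 2) g ⟩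
      c / 2 * (g * (2 * suc h))       ≡⟨ cong (c / 2 *_) m≡g2h ⟨
      c / 2 * m                       ∎)))
      where
      c≡c/2*2 : c ≡ c / 2 * 2
      c≡c/2*2 = trans (m≡m%n+[m/n]*n c 2) (cong (_+ c / 2 * 2) c%2≡0)
      lemma : ∀ h c' g → h * (c' * 2 * g) ≡ c' * (g * (2 * h))
      lemma = solve-∀

module BlockParity {k : ℕ} (h g : ℕ) (modulus≡2hg : suc k ≡ 2 * h * g) where

  open AbelianGroup (ℤ-mod-abelianGroup k) using (_∙_; _⁻¹)
  open AbelianGroupProperties (ℤ-mod-abelianGroup k) using (⁻¹-anti-homo‿-)

  private
    instance
      2hg≢0 : NonZero (2 * h * g)
      2hg≢0 = subst NonZero modulus≡2hg _
      2h≢0 : NonZero (2 * h)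
      2h≢0 = m*n≢0⇒m≢0 (2 * h)
      g≢0 : NonZero g
      g≢0 = m*n≢0⇒n≢0 (2 * h)

  oddMultiple≢0 : ∀ {x} → IsOddMultiple g x → x ≢ 0
  oddMultiple≢0 (o@(suc _) , x≡og , _) x≡0 = ≢-nonZero⁻¹ (o * g) {{m*n≢0 o g}} (trans (sym x≡og) x≡0)

  blockParity : Fin (suc k) → ℕ
  blockParity z = toℕ z / g % 2

  blockParity≡0⊎1 : ∀ z → blockParity z ≡ 0 ⊎ blockParity z ≡ 1
  blockParity≡0⊎1 z = m%2≡0⊎m%2≡1 (toℕ z / g)

  -- 2g divides the modulus, so reducing mod suc k does not change the block parity.
  blockParity-∙-oddMultiple : ∀ {c} → IsOddMultiple g (toℕ c) → ∀ z → blockParity (z ∙ c) + blockParity z ≡ 1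
  blockParity-∙-oddMultiple {c} (o , c≡og , o-odd) z = begin
    toℕ (z ∙ c) / g % 2 + blockParity z            ≡⟨ cong (λ x → x / g % 2 + blockParity z) (toℕ-addMod z c) ⟩
    (Z + toℕ c) % suc k / g % 2 + blockParity z    ≡⟨ cong (λ x → x / g % 2 + blockParity z) (%-congʳ {o = Z + toℕ c} modulus≡2hg) ⟩
    (Z + toℕ c) % (2 * h * g) / g % 2 + blockParity z ≡⟨ cong (λ x → x % 2 + blockParity z) (m%[n*o]/o≡m/o%n (Z + toℕ c) (2 * h) g) ⟩
    (Z + toℕ c) / g % (2 * h) % 2 + blockParity z  ≡⟨ cong (_+ blockParity z) (m∣n⇒o%n%m≡o%m 2 (2 * h) ((Z + toℕ c) / g) (divides h (*-comm 2 h))) ⟩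
    (Z + toℕ c) / g % 2 + blockParity z            ≡⟨ cong (λ x → (Z + x) / g % 2 + blockParity z) c≡og ⟩
    (Z + o * g) / g % 2 + blockParity z            ≡⟨ cong (λ x → x % 2 + blockParity z) (+-distrib-/-∣ʳ Z (n∣m*n o)) ⟩
    (Z / g + o * g / g) % 2 + blockParity z        ≡⟨ cong (λ x → (Z / g + x) % 2 + blockParity z) (m*n/n≡m o g) ⟩
    (Z / g + o) % 2 + Z / g % 2                    ≡⟨ [m+odd]%2+m%2≡1 (Z / g) ⟩
    1                                              ∎
    where
    Z = toℕ z
    [m+odd]%2+m%2≡1 : ∀ m → (m + o) % 2 + m % 2 ≡ 1
    [m+odd]%2+m%2≡1 m = begin
      (m + o) % 2 + m % 2         ≡⟨ cong (_+ m % 2) (%-distribˡ-+ m o 2) ⟩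
      (m % 2 + o % 2) % 2 + m % 2 ≡⟨ cong (λ x → (m % 2 + x) % 2 + m % 2) o-odd ⟩
      (m % 2 + 1) % 2 + m % 2     ≡⟨ bit-flip (m%2≡0⊎m%2≡1 m) ⟩
      1                           ∎
      where bit-flip : ∀ {b} → b ≡ 0 ⊎ b ≡ 1 → (b + 1) % 2 + b ≡ 1
            bit-flip (inj₁ refl) = refl
            bit-flip (inj₂ refl) = refl

  module _ {c : Fin (suc k)} (c-odd : IsOddMultiple g (toℕ c)) (z : Fin (suc k)) where

    blockParity≡0⇒∙oddMultiple≡1 : blockParity z ≡ 0 → blockParity (z ∙ c) ≡ 1
    blockParity≡0⇒∙oddMultiple≡1 p≡0 = begin
      blockParity (z ∙ c)                 ≡⟨ +-identityʳ _ ⟨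
      blockParity (z ∙ c) + 0             ≡⟨ cong (blockParity (z ∙ c) +_) p≡0 ⟨
      blockParity (z ∙ c) + blockParity z ≡⟨ blockParity-∙-oddMultiple c-odd z ⟩
      1                                   ∎

    blockParity≡1⇒∙oddMultiple≡0 : blockParity z ≡ 1 → blockParity (z ∙ c) ≡ 0
    blockParity≡1⇒∙oddMultiple≡0 p≡1 = +-cancelʳ-≡ 1 (blockParity (z ∙ c)) 0
      (trans (cong (blockParity (z ∙ c) +_) (sym p≡1)) (blockParity-∙-oddMultiple c-odd z))

    ∙oddMultiple≡1⇒blockParity≡0 : blockParity (z ∙ c) ≡ 1 → blockParity z ≡ 0
    ∙oddMultiple≡1⇒blockParity≡0 p≡1 = +-cancelˡ-≡ 1 (blockParity z) 0
      (trans (cong (_+ blockParity z) (sym p≡1)) (blockParity-∙-oddMultiple c-odd z))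

  -- -(o g) = (2h - o) g, and 2h - o is odd because 2h is even.
  oddMultiple-⁻¹ : ∀ {c} → IsOddMultiple g (toℕ c) → IsOddMultiple g (toℕ (c ⁻¹))
  oddMultiple-⁻¹ {c} (o@(suc _) , c≡og , o-odd) = 2 * h ∸ o , c⁻¹≡[2h∸o]g , 2h∸o-odd
    where
    og<2hg : o * g < 2 * h * g
    og<2hg = subst₂ _<_ c≡og modulus≡2hg (toℕ<n c)
    o<2h : o < 2 * h
    o<2h = *-cancelʳ-< g o (2 * h) og<2hg
    c⁻¹≡[2h∸o]g : toℕ (c ⁻¹) ≡ (2 * h ∸ o) * g
    c⁻¹≡[2h∸o]g = begin
      toℕ (c ⁻¹)                 ≡⟨ toℕ-negMod c ⟩
      (suc k ∸ toℕ c) % suc k    ≡⟨ m<n⇒m%n≡m (∸-monoʳ-< (subst (0 <_) (sym c≡og) (>-nonZero⁻¹ (o * g) {{m*n≢0 o g}})) (<⇒≤ (toℕ<n c))) ⟩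
      suc k ∸ toℕ c              ≡⟨ cong₂ _∸_ modulus≡2hg c≡og ⟩
      2 * h * g ∸ o * g          ≡⟨ *-distribʳ-∸ g (2 * h) o ⟨
      (2 * h ∸ o) * g            ∎
    2h∸o-odd : (2 * h ∸ o) % 2 ≡ 1
    2h∸o-odd with m%2≡0⊎m%2≡1 (2 * h ∸ o)
    ... | inj₂ odd = odd
    ... | inj₁ even = ⊥-elim (0≢1+n (begin
      0                          ≡⟨ m*n%n≡0 h 2 ⟨
      h * 2 % 2                  ≡⟨ cong (_% 2) (*-comm h 2) ⟩
      2 * h % 2                  ≡⟨ cong (_% 2) (m∸n+n≡m (<⇒≤ o<2h)) ⟨
      (2 * h ∸ o + o) % 2        ≡⟨ %-distribˡ-+ (2 * h ∸ o) o 2 ⟩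
      ((2 * h ∸ o) % 2 + o % 2) % 2 ≡⟨ cong₂ (λ a b → (a + b) % 2) even o-odd ⟩
      1                          ∎))

  oddMultiple-reorient : ∀ (u v : Fin (suc k)) {d} → subMod u v ≡ d ⊎ subMod v u ≡ d → IsOddMultiple g (toℕ d) → IsOddMultiple g (toℕ (subMod v u))
  oddMultiple-reorient u v (inj₁ refl) d-odd = subst (λ x → IsOddMultiple g (toℕ x)) (⁻¹-anti-homo‿- u v) (oddMultiple-⁻¹ d-odd)
  oddMultiple-reorient u v (inj₂ refl) d-odd = d-odd

-- Sums and multiplicities in lists

open CommutativeSemigroupProperties +-commutativeSemigroup using () renaming (interchange to +-interchange)

≤-≤-+≡⇒≡ : ∀ {a b c d} → a ≤ b → c ≤ d → a + c ≡ b + d → a ≡ b × c ≡ d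
≤-≤-+≡⇒≡ {a} {b} {c} {d} a≤b c≤d a+c≡b+d = a≡b , +-cancelˡ-≡ a c d (trans a+c≡b+d (cong (_+ d) (sym a≡b)))
  where
  a≡b : a ≡ b
  a≡b = ≤-antisym a≤b (+-cancelʳ-≤ d b a (≤-trans (≤-reflexive (sym a+c≡b+d)) (+-monoʳ-≤ a c≤d)))

module _ {A : Set} where

  sum-map-+ : ∀ (f g : A → ℕ) xs → sum (map (λ y → f y + g y) xs) ≡ sum (map f xs) + sum (map g xs)
  sum-map-+ f g [] = refl
  sum-map-+ f g (x ∷ xs) = trans (cong (f x + g x +_) (sum-map-+ f g xs)) (+-interchange (f x) (g x) _ _)

  sum-map-0 : ∀ (xs : List A) → sum (map (λ _ → 0) xs) ≡ 0
  sum-map-0 []       = refl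
  sum-map-0 (x ∷ xs) = sum-map-0 xs

  sum-map-1 : ∀ (xs : List A) → sum (map (λ _ → 1) xs) ≡ length xs
  sum-map-1 []       = refl
  sum-map-1 (x ∷ xs) = cong suc (sum-map-1 xs)

  sum-map-mono-≤ : ∀ {f g : A → ℕ} xs → (∀ {y} → y ∈ xs → f y ≤ g y) → sum (map f xs) ≤ sum (map g xs)
  sum-map-mono-≤ []       f≤g = z≤n
  sum-map-mono-≤ (x ∷ xs) f≤g = +-mono-≤ (f≤g (here refl)) (sum-map-mono-≤ xs (f≤g ∘′ there))

  sum-map-≤⇒≡ : ∀ {f g : A → ℕ} xs → (∀ {y} → y ∈ xs → f y ≤ g y) →
                sum (map f xs) ≡ sum (map g xs) → ∀ {y} → y ∈ xs → f y ≡ g y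
  sum-map-≤⇒≡ (x ∷ xs) f≤g Σf≡Σg (here refl) =
    proj₁ (≤-≤-+≡⇒≡ (f≤g (here refl)) (sum-map-mono-≤ xs (f≤g ∘′ there)) Σf≡Σg)
  sum-map-≤⇒≡ (x ∷ xs) f≤g Σf≡Σg (there y∈xs) =
    sum-map-≤⇒≡ xs (f≤g ∘′ there) (proj₂ (≤-≤-+≡⇒≡ (f≤g (here refl)) (sum-map-mono-≤ xs (f≤g ∘′ there)) Σf≡Σg)) y∈xs

module Multiplicity {A : Set} (_≟_ : DecidableEquality A) where

  [_≡?_] : A → A → ℕ
  [ a ≡? b ] = if does (a ≟ b) then 1 else 0

  count : A → List A → ℕ
  count x xs = sum (map [_≡? x ] xs)

  [x≡?x]≡1 : ∀ x → [ x ≡? x ] ≡ 1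
  [x≡?x]≡1 x with x ≟ x
  ... | yes _   = refl
  ... | no x≢x = ⊥-elim (x≢x refl)

  [x≡?y]≡0 : ∀ {x y} → x ≢ y → [ x ≡? y ] ≡ 0
  [x≡?y]≡0 {x} {y} x≢y with x ≟ y
  ... | yes x≡y = ⊥-elim (x≢y x≡y)
  ... | no _    = refl

  [≡?]-sym : ∀ x y → [ x ≡? y ] ≡ [ y ≡? x ]
  [≡?]-sym x y with x ≟ y
  ... | yes refl = sym ([x≡?x]≡1 x)
  ... | no x≢y   = sym ([x≡?y]≡0 (x≢y ∘′ sym))

  count-++ : ∀ x xs ys → count x (xs ++ ys) ≡ count x xs + count x ys
  count-++ x xs ys = trans (cong sum (map-++ [_≡? x ] xs ys)) (sum-++ (map [_≡? x ] xs) (map [_≡? x ] ys))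

  count-↭ : ∀ x {xs ys} → xs ↭ ys → count x xs ≡ count x ys
  count-↭ x xs↭ys = sum-↭ (map⁺ [_≡? x ] xs↭ys)

  ∈⇒1≤count : ∀ {x xs} → x ∈ xs → 1 ≤ count x xs
  ∈⇒1≤count {x} {_ ∷ xs} (here refl) = subst (λ b → 1 ≤ b + count x xs) (sym ([x≡?x]≡1 x)) (s≤s z≤n)
  ∈⇒1≤count {x} {y ∷ xs} (there x∈xs) = ≤-trans (∈⇒1≤count x∈xs) (m≤n+m (count x xs) [ y ≡? x ])

  1≤count⇒∈ : ∀ {x} xs → 1 ≤ count x xs → x ∈ xs
  1≤count⇒∈ {x} (y ∷ xs) 1≤count with y ≟ x
  ... | yes y≡x = here (sym y≡x)
  ... | no _    = there (1≤count⇒∈ xs 1≤count)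

  count≗⇒↭ : ∀ xs ys → (∀ z → count z xs ≡ count z ys) → xs ↭ ys
  count≗⇒↭ [] [] _ = ↭-refl
  count≗⇒↭ [] (y ∷ ys) count≗ =
    ⊥-elim (1+n≰n (≤-trans (∈⇒1≤count {xs = y ∷ ys} (here refl)) (≤-reflexive (sym (count≗ y)))))
  count≗⇒↭ (x ∷ xs) ys count≗
    with ∈-∃++ (1≤count⇒∈ ys (subst (1 ≤_) (count≗ x) (∈⇒1≤count {xs = x ∷ xs} (here refl))))
  ... | us , vs , refl = ↭-trans (prep x (count≗⇒↭ xs (us ++ vs) count≗′)) (↭-sym (shift x us vs))
    where
    count≗′ : ∀ z → count z xs ≡ count z (us ++ vs)
    count≗′ z = +-cancelˡ-≡ [ x ≡? z ] (count z xs) (count z (us ++ vs)) (begin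
      [ x ≡? z ] + count z xs                 ≡⟨ count≗ z ⟩
      count z (us ++ x ∷ vs)                  ≡⟨ count-↭ z (shift x us vs) ⟩
      [ x ≡? z ] + count z (us ++ vs)         ∎)

  count-≤-concat : ∀ x {xs} xss → xs ∈ xss → count x xs ≤ count x (concat xss)
  count-≤-concat x {xs} (_ ∷ xss) (here refl) =
    subst (count x xs ≤_) (sym (count-++ x xs (concat xss))) (m≤m+n _ _)
  count-≤-concat x {xs} (ys ∷ xss) (there xs∈xss) =
    subst (count x xs ≤_) (sym (count-++ x ys (concat xss))) (≤-trans (count-≤-concat x xss xs∈xss) (m≤n+m _ _))

module _ {A B : Set} (_≟A_ : DecidableEquality A) (_≟B_ : DecidableEquality B) where
  private
    module MA = Multiplicity _≟A_
    module MB = Multiplicity _≟B_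

  count-map-injective : ∀ (f : A → B) → (∀ {a b} → f a ≡ f b → a ≡ b) →
                        ∀ x xs → MB.count (f x) (map f xs) ≡ MA.count x xs
  count-map-injective f f-inj x [] = refl
  count-map-injective f f-inj x (y ∷ xs) = cong₂ _+_ bracket (count-map-injective f f-inj x xs)
    where
    bracket : MB.[ f y ≡? f x ] ≡ MA.[ y ≡? x ]
    bracket with y ≟A x
    ... | yes refl = MB.[x≡?x]≡1 (f y)
    ... | no y≢x   = MB.[x≡?y]≡0 (y≢x ∘′ f-inj)

  count-map-∉ : ∀ (f : A → B) z → (∀ a → f a ≢ z) → ∀ xs → MB.count z (map f xs) ≡ 0
  count-map-∉ f z z∉f[A] []       = refl
  count-map-∉ f z z∉f[A] (y ∷ xs) = cong₂ _+_ (MB.[x≡?y]≡0 (z∉f[A] y)) (count-map-∉ f z z∉f[A] xs)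

allFin-suc : ∀ n → allFin (suc n) ≡ fzero ∷ map fsuc (allFin n)
allFin-suc n = cong (fzero ∷_) (sym (map-tabulate (λ i → i) fsuc))

count-allFin : ∀ {n} (z : Fin n) → Multiplicity.count _≟_ z (allFin n) ≡ 1
count-allFin {suc n} z = trans (cong (count z) (allFin-suc n)) (count-0∷map-suc z)
  where
  open Multiplicity (_≟_ {suc n})
  count-0∷map-suc : ∀ z → count z (fzero ∷ map fsuc (allFin n)) ≡ 1
  count-0∷map-suc fzero = cong₂ _+_ ([x≡?x]≡1 fzero)
    (count-map-∉ _≟_ _≟_ fsuc fzero (λ _ ()) (allFin n))
  count-0∷map-suc (fsuc z) = cong₂ _+_ ([x≡?y]≡0 {fzero} {fsuc z} (λ ()))
    (trans (count-map-injective _≟_ _≟_ fsuc fsuc-injective z (allFin n)) (count-allFin z))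

map-allFin-↭ : ∀ {n} (f g : Fin n → Fin n) → (∀ x → f (g x) ≡ x) → (∀ x → g (f x) ≡ x) →
               map f (allFin n) ↭ allFin n
map-allFin-↭ {n} f g f∘g≗id g∘f≗id = count≗⇒↭ (map f (allFin n)) (allFin n) (λ z → begin
  count z (map f (allFin n))       ≡⟨ cong (λ w → count w (map f (allFin n))) (f∘g≗id z) ⟨
  count (f (g z)) (map f (allFin n)) ≡⟨ count-map-injective _≟_ _≟_ f f-injective (g z) (allFin n) ⟩
  count (g z) (allFin n)           ≡⟨ count-allFin (g z) ⟩
  1                                ≡⟨ count-allFin z ⟨
  count z (allFin n)               ∎)
  where
  open Multiplicity (_≟_ {n})
  f-injective : ∀ {a b} → f a ≡ f b → a ≡ b
  f-injective {a} {b} fa≡fb = trans (sym (g∘f≗id a)) (trans (cong g fa≡fb) (g∘f≗id b))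

-- Cycles and 2-regular graphs as lists of vertex lists

module _ {A B : Set} (f : A → B) where

  rotate-map : ∀ c → rotate (map f c) ≡ map f (rotate c)
  rotate-map []      = refl
  rotate-map (x ∷ c) = sym (map-++ f c [ x ])

  cycleEdges-map : ∀ c → cycleEdges (map f c) ≡ map (Product.map f f) (cycleEdges c)
  cycleEdges-map c = trans (cong (zip (map f c)) (rotate-map c)) (zip-map f f c (rotate c))

  graphEdges-map : ∀ G → graphEdges (map (map f) G) ≡ map (Product.map f f) (graphEdges G)
  graphEdges-map []      = refl
  graphEdges-map (c ∷ G) = trans (cong₂ _++_ (cycleEdges-map c) (graphEdges-map G))
                                 (sym (map-++ (Product.map f f) (cycleEdges c) (graphEdges G)))

  Adj-map : ∀ {G a b} → Adj G a b → Adj (map (map f) G) (f a) (f b)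
  Adj-map {G} (inj₁ ab∈) = inj₁ (subst ((f _ , f _) ∈_) (sym (graphEdges-map G)) (∈-map⁺ (Product.map f f) ab∈))
  Adj-map {G} (inj₂ ba∈) = inj₂ (subst ((f _ , f _) ∈_) (sym (graphEdges-map G)) (∈-map⁺ (Product.map f f) ba∈))

  map-length-map-map : ∀ G → map length (map (map f) G) ≡ map length G
  map-length-map-map []      = refl
  map-length-map-map (c ∷ G) = cong₂ _∷_ (length-map f c) (map-length-map-map G)

module _ {A : Set} where

  map-proj₁-zip : ∀ (xs ys : List A) → length xs ≡ length ys → map proj₁ (zip xs ys) ≡ xs
  map-proj₁-zip []       []       _  = refl
  map-proj₁-zip (x ∷ xs) (y ∷ ys) eq = cong (x ∷_) (map-proj₁-zip xs ys (cong pred eq))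

  map-proj₂-zip : ∀ (xs ys : List A) → length xs ≡ length ys → map proj₂ (zip xs ys) ≡ ys
  map-proj₂-zip []       []       _  = refl
  map-proj₂-zip (x ∷ xs) (y ∷ ys) eq = cong (y ∷_) (map-proj₂-zip xs ys (cong pred eq))

  length-rotate : ∀ (c : List A) → length (rotate c) ≡ length c
  length-rotate []      = refl
  length-rotate (x ∷ c) = trans (length-++ c) (+-comm (length c) 1)

  rotate-↭ : ∀ (c : List A) → rotate c ↭ c
  rotate-↭ []      = ↭-refl
  rotate-↭ (x ∷ c) = ↭-sym (∷↭∷ʳ x c)

  map-proj₁-cycleEdges : ∀ c → map proj₁ (cycleEdges c) ≡ c
  map-proj₁-cycleEdges c = map-proj₁-zip c (rotate c) (sym (length-rotate c))

  map-proj₂-cycleEdges : ∀ c → map proj₂ (cycleEdges c) ↭ c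
  map-proj₂-cycleEdges c = subst (_↭ c) (sym (map-proj₂-zip c (rotate c) (sym (length-rotate c)))) (rotate-↭ c)

  map-proj₁-graphEdges : ∀ G → map proj₁ (graphEdges G) ≡ concat G
  map-proj₁-graphEdges []      = refl
  map-proj₁-graphEdges (c ∷ G) = trans (map-++ proj₁ (cycleEdges c) (graphEdges G))
                                       (cong₂ _++_ (map-proj₁-cycleEdges c) (map-proj₁-graphEdges G))

  map-proj₂-graphEdges : ∀ G → map proj₂ (graphEdges G) ↭ concat G
  map-proj₂-graphEdges []      = ↭-refl
  map-proj₂-graphEdges (c ∷ G) = subst (_↭ concat (c ∷ G)) (sym (map-++ proj₂ (cycleEdges c) (graphEdges G)))
                                       (++⁺ (map-proj₂-cycleEdges c) (map-proj₂-graphEdges G))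

  ∈⇒∃successor : ∀ {x} c → x ∈ c → ∃[ y ] (x , y) ∈ cycleEdges c
  ∈⇒∃successor {x} c x∈c with ∈-map⁻ proj₁ (subst (x ∈_) (sym (map-proj₁-cycleEdges c)) x∈c)
  ... | (_ , y) , xy∈ , refl = y , xy∈

  -- For w₀ = y these are, definitionally, the edges of the cycle y ∷ xs.
  private
    pathEdges : A → List A → A → List (A × A)
    pathEdges y xs w₀ = zip (y ∷ xs) (xs ++ [ w₀ ])

  subdividePath : ∀ (v : A) y xs w₀ {a b} → (a , b) ∈ pathEdges y xs w₀ →
    ∃[ xs′ ] (y ∷ xs′ ↭ v ∷ y ∷ xs)
           × (a , v) ∈ pathEdges y xs′ w₀ × (v , b) ∈ pathEdges y xs′ w₀
           × (∀ {e} → e ∈ pathEdges y xs w₀ → e ≢ (a , b) → e ∈ pathEdges y xs′ w₀)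
  subdividePath v y [] w₀ (here refl) =
    v ∷ [] , swap y v ↭-refl , here refl , there (here refl) , keep
    where keep : ∀ {e} → e ∈ pathEdges y [] w₀ → e ≢ (y , w₀) → e ∈ pathEdges y (v ∷ []) w₀
          keep (here refl) e≢ = ⊥-elim (e≢ refl)
  subdividePath v y (z ∷ zs) w₀ (here refl) =
    v ∷ z ∷ zs , swap y v ↭-refl , here refl , there (here refl) , keep
    where keep : ∀ {e} → e ∈ pathEdges y (z ∷ zs) w₀ → e ≢ (y , z) → e ∈ pathEdges y (v ∷ z ∷ zs) w₀
          keep (here refl) e≢ = ⊥-elim (e≢ refl)
          keep (there e∈)  _  = there (there e∈)
  subdividePath v y (z ∷ zs) w₀ (there ab∈) with subdividePath v z zs w₀ ab∈
  ... | zs′ , zs′↭ , av∈ , vb∈ , keep′ =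
    z ∷ zs′ , ↭-trans (prep y zs′↭) (swap y v ↭-refl) , there av∈ , there vb∈ , keep
    where keep : ∀ {e} → e ∈ pathEdges y (z ∷ zs) w₀ → e ≢ _ → e ∈ pathEdges y (z ∷ zs′) w₀
          keep (here refl) _  = here refl
          keep (there e∈)  e≢ = there (keep′ e∈ e≢)

  record Subdivision (v : A) (c : List A) (G : List (List A)) (a b : A) : Set where
    field
      cycle      : List A
      cycle↭     : cycle ↭ v ∷ c
      av∈        : (a , v) ∈ graphEdges (cycle ∷ G)
      vb∈        : (v , b) ∈ graphEdges (cycle ∷ G)
      other-edge : ∀ {e} → e ∈ graphEdges (c ∷ G) → e ≢ (a , b) → e ∈ graphEdges (cycle ∷ G)

  subdivideGraph : ∀ (v : A) c G {a b} → (a , b) ∈ cycleEdges c → Subdivision v c G a b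
  subdivideGraph v (y ∷ xs) G ab∈ with subdividePath v y xs y ab∈
  ... | xs′ , c′↭ , av∈ , vb∈ , keep = record
    { cycle = y ∷ xs′ ; cycle↭ = c′↭ ; av∈ = ∈-++⁺ˡ av∈ ; vb∈ = ∈-++⁺ˡ vb∈ ; other-edge = keepGraph }
    where keepGraph : ∀ {e} → e ∈ graphEdges ((y ∷ xs) ∷ G) → e ≢ _ → e ∈ graphEdges ((y ∷ xs′) ∷ G)
          keepGraph e∈ e≢ with ∈-++⁻ (cycleEdges (y ∷ xs)) e∈
          ... | inj₁ e∈c = ∈-++⁺ˡ (keep e∈c e≢)
          ... | inj₂ e∈G = ∈-++⁺ʳ _ e∈G

module _ {A : Set} (_≟_ : DecidableEquality A) where
  open Multiplicity _≟_

  private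
    loop-in-path : ∀ {a} y xs w₀ → (a , a) ∈ zip (y ∷ xs) (xs ++ [ w₀ ]) →
                   2 ≤ count a (y ∷ xs) ⊎ (a ≡ w₀ × ∃[ zs ] y ∷ xs ≡ zs ++ [ a ])
    loop-in-path y [] w₀ (here refl) = inj₂ (refl , [] , refl)
    loop-in-path {a} y (z ∷ zs) w₀ (here refl) =
      inj₁ (subst (λ b → 2 ≤ b + count a (a ∷ zs)) (sym ([x≡?x]≡1 a))
             (s≤s (∈⇒1≤count {xs = a ∷ zs} (here refl))))
    loop-in-path {a} y (z ∷ zs) w₀ (there aa∈) with loop-in-path z zs w₀ aa∈
    ... | inj₁ 2≤count           = inj₁ (≤-trans 2≤count (m≤n+m _ [ y ≡? a ]))
    ... | inj₂ (a≡w₀ , us , eq) = inj₂ (a≡w₀ , y ∷ us , cong (y ∷_) eq)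

  loop⇒2≤count : ∀ {a} c → (a , a) ∈ cycleEdges c → 2 ≤ length c → 2 ≤ count a c
  loop⇒2≤count (y ∷ xs) aa∈ 2≤length with loop-in-path y xs y aa∈
  ... | inj₁ 2≤count              = 2≤count
  ... | inj₂ (refl , [] , refl)   with 2≤length
  ...   | s≤s ()
  loop⇒2≤count {a} (y ∷ xs) aa∈ 2≤length | inj₂ (refl , _ ∷ us , refl) =
    subst (λ b → 2 ≤ b + count a (us ++ [ a ])) (sym ([x≡?x]≡1 a))
      (s≤s (∈⇒1≤count (∈-++⁺ʳ us (here refl))))

  -- A loop at x would make x occur twice in its cycle.
  ∃successor≢ : ∀ {vs G x} → IsTwoRegularOn vs G → count x vs ≡ 1 → ∃[ y ] y ≢ x × (x , y) ∈ graphEdges G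
  ∃successor≢ {vs} {G} {x} (lengths , concatG↭vs) count≡1
    with ∈-concat⁻′ G (∈-resp-↭ (↭-sym concatG↭vs) (1≤count⇒∈ vs (≤-reflexive (sym count≡1))))
  ... | c , x∈c , c∈G with ∈⇒∃successor c x∈c
  ...   | y , xy∈c = y , y≢x , ∈-concat⁺′ xy∈c (∈-map⁺ cycleEdges c∈G)
    where
    y≢x : y ≢ x
    y≢x refl = 1+n≰n
      (≤-trans (loop⇒2≤count c xy∈c (≤-trans (s≤s (s≤s z≤n)) (All.lookup lengths c∈G)))
      (≤-trans (count-≤-concat x G c∈G)
               (≤-reflexive (trans (count-↭ x concatG↭vs) count≡1))))

-- Degrees in a family of 2-factors

CompleteMinus : ∀ {V} → (Fin V → Fin V) → Fin V → Fin V → Set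
CompleteMinus M x y = x ≢ y × y ≢ M x

module _ {V : ℕ} where
  open Multiplicity (_≟_ {V})

  private
    occ-∷ : ∀ (x y a b : Fin V) es → occ x y ((a , b) ∷ es) ≡ (if does (a ≟ x) ∧ does (b ≟ y) then 1 else 0) + occ x y es
    occ-∷ x y a b es with does (a ≟ x) ∧ does (b ≟ y)
    ... | true  = refl
    ... | false = refl

    sum-[≡?] : ∀ b → sum (map (λ y → [ b ≡? y ]) (allFin V)) ≡ 1
    sum-[≡?] b = trans (cong sum (map-cong (λ y → [≡?]-sym b y) (allFin V))) (count-allFin b)

  1≤occ : ∀ {x y : Fin V} es → (x , y) ∈ es → 1 ≤ occ x y es
  1≤occ {x} {y} ((a , b) ∷ es) (here refl) rewrite occ-∷ x y x y es with x ≟ x | y ≟ y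
  ... | yes _   | yes _   = s≤s z≤n
  ... | no x≢x  | _       = ⊥-elim (x≢x refl)
  ... | yes _   | no y≢y  = ⊥-elim (y≢y refl)
  1≤occ {x} {y} ((a , b) ∷ es) (there xy∈) rewrite occ-∷ x y a b es = ≤-trans (1≤occ es xy∈) (m≤n+m _ _)

  sum-occ-from : ∀ (x : Fin V) es → sum (map (λ y → occ x y es) (allFin V)) ≡ count x (map proj₁ es)
  sum-occ-from x [] = sum-map-0 (allFin V)
  sum-occ-from x ((a , b) ∷ es) = begin
    sum (map (λ y → occ x y ((a , b) ∷ es)) (allFin V))
      ≡⟨ cong sum (map-cong (λ y → occ-∷ x y a b es) (allFin V)) ⟩
    sum (map (λ y → (if does (a ≟ x) ∧ does (b ≟ y) then 1 else 0) + occ x y es) (allFin V))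
      ≡⟨ sum-map-+ _ _ (allFin V) ⟩
    sum (map (λ y → if does (a ≟ x) ∧ does (b ≟ y) then 1 else 0) (allFin V)) + sum (map (λ y → occ x y es) (allFin V))
      ≡⟨ cong₂ _+_ (row (a ≟ x)) (sum-occ-from x es) ⟩
    [ a ≡? x ] + count x (map proj₁ es)
      ∎
    where
    row : (d : Dec (a ≡ x)) → sum (map (λ y → if does d ∧ does (b ≟ y) then 1 else 0) (allFin V)) ≡ (if does d then 1 else 0)
    row (yes _) = sum-[≡?] b
    row (no _)  = sum-map-0 (allFin V)

  sum-occ-to : ∀ (x : Fin V) es → sum (map (λ y → occ y x es) (allFin V)) ≡ count x (map proj₂ es)
  sum-occ-to x [] = sum-map-0 (allFin V)
  sum-occ-to x ((a , b) ∷ es) = begin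
    sum (map (λ y → occ y x ((a , b) ∷ es)) (allFin V))
      ≡⟨ cong sum (map-cong (λ y → occ-∷ y x a b es) (allFin V)) ⟩
    sum (map (λ y → (if does (a ≟ y) ∧ does (b ≟ x) then 1 else 0) + occ y x es) (allFin V))
      ≡⟨ sum-map-+ _ _ (allFin V) ⟩
    sum (map (λ y → if does (a ≟ y) ∧ does (b ≟ x) then 1 else 0) (allFin V)) + sum (map (λ y → occ y x es) (allFin V))
      ≡⟨ cong₂ _+_ (column (b ≟ x)) (sum-occ-to x es) ⟩
    [ b ≡? x ] + count x (map proj₂ es)
      ∎
    where
    column : (d : Dec (b ≡ x)) → sum (map (λ y → if does (a ≟ y) ∧ does d then 1 else 0) (allFin V)) ≡ (if does d then 1 else 0)
    column (yes _) = trans (cong sum (map-cong (λ y → cong (if_then 1 else 0) (∧-identityʳ (does (a ≟ y)))) (allFin V))) (sum-[≡?] a)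
    column (no _)  = trans (cong sum (map-cong (λ y → cong (if_then 1 else 0) (∧-zeroʳ (does (a ≟ y)))) (allFin V))) (sum-map-0 (allFin V))

  count-endpoints : (π : Fin V × Fin V → Fin V) → (∀ G → map π (graphEdges G) ↭ concat G) →
                    ∀ x fs → All (λ f → concat f ↭ allFin V) fs →
                    count x (map π (concatMap graphEdges fs)) ≡ length fs
  count-endpoints π π↭ x [] [] = refl
  count-endpoints π π↭ x (f ∷ fs) (f-spans ∷ fs-span) = begin
    count x (map π (graphEdges f ++ concatMap graphEdges fs))
      ≡⟨ cong (count x) (map-++ π (graphEdges f) (concatMap graphEdges fs)) ⟩
    count x (map π (graphEdges f) ++ map π (concatMap graphEdges fs))
      ≡⟨ count-++ x (map π (graphEdges f)) _ ⟩
    count x (map π (graphEdges f)) + count x (map π (concatMap graphEdges fs))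
      ≡⟨ cong₂ _+_ (trans (count-↭ x (↭-trans (π↭ f) f-spans)) (count-allFin x)) (count-endpoints π π↭ x fs fs-span) ⟩
    suc (length fs)
      ∎

-- Each factor gives every vertex degree 2, and V - 2 = 2 · #factors is the degree in K_V - M;
-- so a covering of K_V - M by the factors is automatically exact.
module DoubleCounting {V : ℕ} (M : Fin V → Fin V) (M-fixedPointFree : ∀ x → M x ≢ x)
  (fs : List (List (List (Fin V)))) (fs-span : All (λ f → concat f ↭ allFin V) fs)
  (V≡2+2n : V ≡ 2 + (length fs + length fs))
  (covers : ∀ x y → CompleteMinus M x y → (x , y) ∈ concatMap graphEdges fs ⊎ (y , x) ∈ concatMap graphEdges fs)
  where

  open Multiplicity (_≟_ {V})

  private
    E = concatMap graphEdges fs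

    multiplicity : Fin V → Fin V → ℕ
    multiplicity x y = occ x y E + occ y x E

    indicator : Fin V → Fin V → ℕ
    indicator x y = if does (y ≟ x) then 0 else if does (y ≟ M x) then 0 else 1

    indicator-partition : ∀ x y → indicator x y + [ y ≡? x ] + [ y ≡? M x ] ≡ 1
    indicator-partition x y with y ≟ x | y ≟ M x
    ... | yes refl | yes y≡My = ⊥-elim (M-fixedPointFree y (sym y≡My))
    ... | yes _    | no _     = refl
    ... | no _     | yes _    = refl
    ... | no _     | no _     = refl

    sum-multiplicity : ∀ x → sum (map (multiplicity x) (allFin V)) ≡ length fs + length fs
    sum-multiplicity x = begin
      sum (map (multiplicity x) (allFin V))
        ≡⟨ sum-map-+ _ _ (allFin V) ⟩
      sum (map (λ y → occ x y E) (allFin V)) + sum (map (λ y → occ y x E) (allFin V))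
        ≡⟨ cong₂ _+_ (sum-occ-from x E) (sum-occ-to x E) ⟩
      count x (map proj₁ E) + count x (map proj₂ E)
        ≡⟨ cong₂ _+_ (count-endpoints proj₁ (λ G → ↭-reflexive (map-proj₁-graphEdges G)) x fs fs-span)
                     (count-endpoints proj₂ map-proj₂-graphEdges x fs fs-span) ⟩
      length fs + length fs
        ∎

    sum-indicator : ∀ x → sum (map (indicator x) (allFin V)) ≡ length fs + length fs
    sum-indicator x = suc-injective (suc-injective (begin
      2 + Σind
        ≡⟨ +-comm 2 Σind ⟩
      Σind + 2
        ≡⟨ +-assoc Σind 1 1 ⟨
      Σind + 1 + 1
        ≡⟨ cong₂ (λ a b → Σind + a + b) (count-allFin x) (count-allFin (M x)) ⟨
      Σind + count x (allFin V) + count (M x) (allFin V)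
        ≡⟨ cong (_+ count (M x) (allFin V)) (sum-map-+ (indicator x) [_≡? x ] (allFin V)) ⟨
      sum (map (λ y → indicator x y + [ y ≡? x ]) (allFin V)) + count (M x) (allFin V)
        ≡⟨ sum-map-+ (λ y → indicator x y + [ y ≡? x ]) [_≡? M x ] (allFin V) ⟨
      sum (map (λ y → indicator x y + [ y ≡? x ] + [ y ≡? M x ]) (allFin V))
        ≡⟨ cong sum (map-cong (indicator-partition x) (allFin V)) ⟩
      sum (map (λ _ → 1) (allFin V))
        ≡⟨ sum-map-1 (allFin V) ⟩
      length (allFin V)
        ≡⟨ length-tabulate (λ i → i) ⟩
      V
        ≡⟨ V≡2+2n ⟩
      2 + (length fs + length fs)
        ∎))
      where Σind = sum (map (indicator x) (allFin V))

    indicator≤multiplicity : ∀ x {y} → y ∈ allFin V → indicator x y ≤ multiplicity x y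
    indicator≤multiplicity x {y} _ with y ≟ x | y ≟ M x
    ... | yes _   | _        = z≤n
    ... | no _    | yes _    = z≤n
    ... | no y≢x  | no y≢Mx  with covers x y ((y≢x ∘′ sym) , y≢Mx)
    ...   | inj₁ xy∈ = ≤-trans (1≤occ E xy∈) (m≤m+n _ _)
    ...   | inj₂ yx∈ = ≤-trans (1≤occ E yx∈) (m≤n+m _ _)

    multiplicity≡indicator : ∀ x y → multiplicity x y ≡ indicator x y
    multiplicity≡indicator x y = sym (sum-map-≤⇒≡ (allFin V) (indicator≤multiplicity x)
      (trans (sum-indicator x) (sym (sum-multiplicity x))) (∈-allFin y))

  occ+occ≡1 : ∀ x y → CompleteMinus M x y → occ x y E + occ y x E ≡ 1
  occ+occ≡1 x y (x≢y , y≢Mx) = trans (multiplicity≡indicator x y) indicator≡1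
    where indicator≡1 : indicator x y ≡ 1
          indicator≡1 with y ≟ x | y ≟ M x
          ... | yes y≡x | _        = ⊥-elim (x≢y (sym y≡x))
          ... | no _    | yes y≡Mx = ⊥-elim (y≢Mx y≡Mx)
          ... | no _    | no _     = refl

  ∈⇒CompleteMinus : ∀ {x y} → (x , y) ∈ E → CompleteMinus M x y
  ∈⇒CompleteMinus {x} {y} xy∈ with y ≟ x | y ≟ M x | subst (1 ≤_) (multiplicity≡indicator x y) (≤-trans (1≤occ E xy∈) (m≤m+n _ _))
  ... | no y≢x | no y≢Mx | _ = (y≢x ∘′ sym) , y≢Mx

∈Δ⇒edge : ∀ {m} {d : Fin m} es → d ∈ diffsOfEdges es →
          ∃[ u ] ∃[ v ] (just u , just v) ∈ es × (subMod u v ≡ d ⊎ subMod v u ≡ d)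
∈Δ⇒edge ((just x , just y) ∷ es) (here d≡x-y)         = x , y , here refl , inj₁ (sym d≡x-y)
∈Δ⇒edge ((just x , just y) ∷ es) (there (here d≡y-x)) = x , y , here refl , inj₂ (sym d≡y-x)
∈Δ⇒edge ((just x , just y) ∷ es) (there (there d∈))   with ∈Δ⇒edge es d∈
... | u , v , uv∈ , diff = u , v , there uv∈ , diff
∈Δ⇒edge ((just x , nothing) ∷ es) d∈ with ∈Δ⇒edge es d∈
... | u , v , uv∈ , diff = u , v , there uv∈ , diff
∈Δ⇒edge ((nothing , y) ∷ es) d∈ with ∈Δ⇒edge es d∈
... | u , v , uv∈ , diff = u , v , there uv∈ , diff

∈Δ⇒adjacent : ∀ {m} {d : Fin m} G → d ∈ Δ G → ∃[ a ] ∃[ b ] Adj G (just a) (just b) × subMod a b ≡ d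
∈Δ⇒adjacent G d∈ΔG with ∈Δ⇒edge (graphEdges G) d∈ΔG
... | u , v , uv∈ , inj₁ u-v≡d = u , v , inj₁ uv∈ , u-v≡d
... | u , v , uv∈ , inj₂ v-u≡d = v , u , inj₂ uv∈ , v-u≡d

-- OPSolution with the order sum L abstracted, so that a solution can be transported along an
-- equation for the order.
OPSolutionOfOrder : ℕ → List ℕ → Set₁
OPSolutionOfOrder v L =
  Σ (Fin v → Fin v → Set) λ adj → IsKStar v adj ×
  Σ (List (List (List (Fin v)))) λ fs →
      All (IsTwoFactorOfType v L) fs
    × All (λ e → adj (proj₁ e) (proj₂ e)) (concatMap graphEdges fs)
    × (∀ x y → adj x y → occ x y (concatMap graphEdges fs) + occ y x (concatMap graphEdges fs) ≡ 1)

module Construction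
  (n′ : ℕ)
  (C : List (V∞ (2 * suc n′))) (Fs : List (List (V∞ (2 * suc n′))))
  (F-regular : IsTwoRegularOn (allV∞ (2 * suc n′)) (C ∷ Fs))
  (F-differences : ∀ (d : Fin (2 * suc n′)) → toℕ d ≢ 0 → d ∈ Δ (C ∷ Fs))
  (F+n⊆F : ∀ x y → Adj (translate (C ∷ Fs) (halfElem (suc n′) (s≤s z≤n))) x y → Adj (C ∷ Fs) x y)
  (p q : Fin (2 * suc n′)) (pq∈C : (just p , just q) ∈ cycleEdges C)
  (h g : ℕ) (modulus≡2hg : 2 * suc n′ ≡ 2 * h * g) (h-odd : h % 2 ≡ 1)
  (q-p-odd : IsOddMultiple g (toℕ (subMod q p)))
  where

  n = suc n′
  m = 2 * n
  F = C ∷ Fs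

  ℤₘ : AbelianGroup 0ℓ 0ℓ
  ℤₘ = ℤ-mod-abelianGroup (n′ + (n + 0))

  open AbelianGroup ℤₘ using (_∙_; _⁻¹; _-_; ε; comm; identityʳ; commutativeSemigroup)
  open CommutativeSemigroupProperties commutativeSemigroup using (interchange)
  open AbelianGroupProperties ℤₘ using (//-rightDividesˡ; //-rightDividesʳ; identityʳ-unique; x∙y⁻¹≈ε⇒x≈y)

  open BlockParity h g modulus≡2hg

  n≡hg : n ≡ h * g
  n≡hg = *-cancelˡ-≡ n (h * g) 2 (trans modulus≡2hg (*-assoc 2 h g))

  D : Fin m
  D = q - p

  halfN : Fin m
  halfN = halfElem n (s≤s z≤n)

  toℕ-halfN : toℕ halfN ≡ n
  toℕ-halfN = toℕ-fromℕ< (m<m+n n z<s)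

  halfN-odd : IsOddMultiple g (toℕ halfN)
  halfN-odd = h , trans toℕ-halfN n≡hg , h-odd

  halfN∙halfN≡ε : halfN ∙ halfN ≡ ε
  halfN∙halfN≡ε = toℕ-injective (begin
    toℕ (halfN ∙ halfN)               ≡⟨ toℕ-addMod halfN halfN ⟩
    (toℕ halfN + toℕ halfN) % m       ≡⟨ cong₂ (λ a b → (a + b) % m) toℕ-halfN (trans toℕ-halfN (sym (+-identityʳ n))) ⟩
    m % m                             ≡⟨ n%n≡0 m ⟩
    0                                 ∎)

  D≢ε : D ≢ ε
  D≢ε D≡ε = oddMultiple≢0 q-p-odd (cong toℕ D≡ε)

  partner : ℕ → Fin m → Fin m
  partner zero    z = z ∙ D
  partner (suc _) z = z - D

  Mℤ : Fin m → Fin m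
  Mℤ z = partner (blockParity (z - p)) z

  Mℤ-even : ∀ z → blockParity (z - p) ≡ 0 → Mℤ z ≡ z ∙ D
  Mℤ-even z even rewrite even = refl

  Mℤ-odd : ∀ z → blockParity (z - p) ≡ 1 → Mℤ z ≡ z - D
  Mℤ-odd z odd rewrite odd = refl

  Mℤ-involutive : ∀ z → Mℤ (Mℤ z) ≡ z
  Mℤ-involutive z with blockParity≡0⊎1 (z - p)
  ... | inj₁ even = begin
    Mℤ (Mℤ z)      ≡⟨ cong Mℤ (Mℤ-even z even) ⟩
    Mℤ (z ∙ D)     ≡⟨ Mℤ-odd (z ∙ D) (trans (cong blockParity ([x∙y]-z≈[x-z]∙y ℤₘ z D p))
                                            (blockParity≡0⇒∙oddMultiple≡1 q-p-odd (z - p) even)) ⟩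
    z ∙ D - D      ≡⟨ //-rightDividesʳ D z ⟩
    z              ∎
  ... | inj₂ odd = begin
    Mℤ (Mℤ z)      ≡⟨ cong Mℤ (Mℤ-odd z odd) ⟩
    Mℤ (z - D)     ≡⟨ Mℤ-even (z - D) (∙oddMultiple≡1⇒blockParity≡0 q-p-odd (z - D - p) (begin
                        blockParity ((z - D - p) ∙ D) ≡⟨ cong blockParity ([x∙y]-z≈[x-z]∙y ℤₘ (z - D) D p) ⟨
                        blockParity ((z - D) ∙ D - p) ≡⟨ cong (λ w → blockParity (w - p)) (//-rightDividesˡ D z) ⟩
                        blockParity (z - p)           ≡⟨ odd ⟩
                        1                             ∎)) ⟩
    (z - D) ∙ D    ≡⟨ //-rightDividesˡ D z ⟩
    z              ∎

  Mℤ-fixedPointFree : ∀ z → Mℤ z ≢ z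
  Mℤ-fixedPointFree z Mz≡z with blockParity≡0⊎1 (z - p)
  ... | inj₁ even = D≢ε (identityʳ-unique z D (trans (sym (Mℤ-even z even)) Mz≡z))
  ... | inj₂ odd  = D≢ε (identityʳ-unique z D (begin
    z ∙ D          ≡⟨ cong (_∙ D) (trans (sym (Mℤ-odd z odd)) Mz≡z) ⟨
    (z - D) ∙ D    ≡⟨ //-rightDividesˡ D z ⟩
    z              ∎))

  Mℤ-translate : ∀ t → blockParity t ≡ 0 → Mℤ (p ∙ t) ≡ q ∙ t
  Mℤ-translate t even = begin
    Mℤ (p ∙ t)       ≡⟨ Mℤ-even (p ∙ t) (trans (cong blockParity ([x∙y]-x≈y ℤₘ p t)) even) ⟩
    p ∙ t ∙ (q - p)  ≡⟨ x∙[y-z]≈[x-z]∙y ℤₘ (p ∙ t) q p ⟩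
    (p ∙ t - p) ∙ q  ≡⟨ cong (_∙ q) ([x∙y]-x≈y ℤₘ p t) ⟩
    t ∙ q            ≡⟨ comm t q ⟩
    q ∙ t            ∎

  Vertex : Set
  Vertex = Fin (2 + m)

  ∞′ : Vertex
  ∞′ = fzero

  ι : V∞ m → Vertex
  ι nothing  = fsuc fzero
  ι (just z) = fsuc (fsuc z)

  ι-injective : ∀ {u v} → ι u ≡ ι v → u ≡ v
  ι-injective {nothing} {nothing} _    = refl
  ι-injective {just _}  {just _}  eq = cong just (fsuc-injective (fsuc-injective eq))

  τ : Fin m → Vertex → Vertex
  τ t fzero            = fzero
  τ t (fsuc fzero)     = fsuc fzero
  τ t (fsuc (fsuc z))  = fsuc (fsuc (z ∙ t))

  τ-ι : ∀ t v → τ t (ι v) ≡ ι (shiftV t v)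
  τ-ι t nothing  = refl
  τ-ι t (just z) = refl

  τ∘τ⁻¹ : ∀ t v → τ t (τ (t ⁻¹) v) ≡ v
  τ∘τ⁻¹ t fzero           = refl
  τ∘τ⁻¹ t (fsuc fzero)    = refl
  τ∘τ⁻¹ t (fsuc (fsuc z)) = cong (λ w → fsuc (fsuc w)) (//-rightDividesˡ t z)

  τ⁻¹∘τ : ∀ t v → τ (t ⁻¹) (τ t v) ≡ v
  τ⁻¹∘τ t fzero           = refl
  τ⁻¹∘τ t (fsuc fzero)    = refl
  τ⁻¹∘τ t (fsuc (fsuc z)) = cong (λ w → fsuc (fsuc w)) (//-rightDividesʳ t z)

  M : Vertex → Vertex
  M fzero           = fsuc fzero
  M (fsuc fzero)    = fzero
  M (fsuc (fsuc z)) = fsuc (fsuc (Mℤ z))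

  M-involutive : ∀ x → M (M x) ≡ x
  M-involutive fzero           = refl
  M-involutive (fsuc fzero)    = refl
  M-involutive (fsuc (fsuc z)) = cong (λ w → fsuc (fsuc w)) (Mℤ-involutive z)

  M-fixedPointFree : ∀ x → M x ≢ x
  M-fixedPointFree fzero           ()
  M-fixedPointFree (fsuc fzero)    ()
  M-fixedPointFree (fsuc (fsuc z)) Mx≡x = Mℤ-fixedPointFree z (fsuc-injective (fsuc-injective Mx≡x))

  F̂s : List (List Vertex)
  F̂s = map (map ι) Fs

  ι[pq]∈ι[C] : (ι (just p) , ι (just q)) ∈ cycleEdges (map ι C)
  ι[pq]∈ι[C] = subst ((ι (just p) , ι (just q)) ∈_) (sym (cycleEdges-map ι C)) (∈-map⁺ (Product.map ι ι) pq∈C)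

  open Subdivision (subdivideGraph ∞′ (map ι C) F̂s ι[pq]∈ι[C])
    renaming (cycle to Ĉ; cycle↭ to Ĉ↭; av∈ to p∞′∈G₀; vb∈ to ∞′q∈G₀; other-edge to ι-edge∈G₀)

  G₀ : List (List Vertex)
  G₀ = Ĉ ∷ F̂s

  edge∈G₀ : ∀ {a b} → (a , b) ∈ graphEdges F → (a , b) ≢ (just p , just q) → (ι a , ι b) ∈ graphEdges G₀
  edge∈G₀ {a} {b} ab∈F ab≢pq = ι-edge∈G₀
    (subst ((ι a , ι b) ∈_) (sym (graphEdges-map ι F)) (∈-map⁺ (Product.map ι ι) ab∈F))
    (λ eq → ab≢pq (cong₂ _,_ (ι-injective (cong proj₁ eq)) (ι-injective (cong proj₂ eq))))

  factor : Fin m → List (List Vertex)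
  factor t = map (map (τ t)) G₀

  lift : Fin n → Fin m
  lift i = i ↑ˡ (n + 0)

  evenOf : ℕ → Fin m → Fin m
  evenOf zero    t = t
  evenOf (suc _) t = t ∙ halfN

  representative : Fin n → Fin m
  representative i = evenOf (blockParity (lift i)) (lift i)

  lift-halves : ∀ t → ∃[ i ] (t ≡ lift i ⊎ t ≡ lift i ∙ halfN)
  lift-halves t with toℕ t <? n
  ... | yes t<n = fromℕ< t<n , inj₁ (toℕ-injective (sym (trans (toℕ-↑ˡ (fromℕ< t<n) (n + 0)) (toℕ-fromℕ< t<n))))
  ... | no t≮n  = fromℕ< t∸n<n , inj₂ (toℕ-injective (begin
    toℕ t                                ≡⟨ m<n⇒m%n≡m (toℕ<n t) ⟨
    toℕ t % m                            ≡⟨ cong (_% m) (m∸n+n≡m (≮⇒≥ t≮n)) ⟨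
    (toℕ t ∸ n + n) % m                  ≡⟨ cong₂ (λ a b → (a + b) % m) (trans (toℕ-↑ˡ (fromℕ< t∸n<n) (n + 0)) (toℕ-fromℕ< t∸n<n)) toℕ-halfN ⟨
    (toℕ (lift (fromℕ< t∸n<n)) + toℕ halfN) % m ≡⟨ toℕ-addMod (lift (fromℕ< t∸n<n)) halfN ⟨
    toℕ (lift (fromℕ< t∸n<n) ∙ halfN)    ∎))
    where
    t∸n<n : toℕ t ∸ n < n
    t∸n<n = subst (toℕ t ∸ n <_) (m+n∸n≡m n n) (∸-monoˡ-< (subst (toℕ t <_) (cong (n +_) (+-identityʳ n)) (toℕ<n t)) (≮⇒≥ t≮n))

  representative-surjective : ∀ t → blockParity t ≡ 0 → ∃[ i ] representative i ≡ t
  representative-surjective t even with lift-halves t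
  ... | i , inj₁ refl = i , cong (λ b → evenOf b (lift i)) even
  ... | i , inj₂ refl with blockParity≡0⊎1 (lift i)
  ...   | inj₂ odd   = i , cong (λ b → evenOf b (lift i)) odd
  ...   | inj₁ even′ = ⊥-elim (0≢1+n (trans (sym even) (blockParity≡0⇒∙oddMultiple≡1 halfN-odd (lift i) even′)))

  factors : List (List (List Vertex))
  factors = map (λ i → factor (representative i)) (allFin n)

  E : List (Vertex × Vertex)
  E = concatMap graphEdges factors

  factor⊆E : ∀ t → blockParity t ≡ 0 → ∀ {e} → e ∈ graphEdges (factor t) → e ∈ E
  factor⊆E t even e∈ with representative-surjective t even
  ... | i , refl = ∈-concat⁺′ e∈ (∈-map⁺ graphEdges (∈-map⁺ (λ i → factor (representative i)) (∈-allFin i)))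

  translate∈factor : ∀ t {x y} → (x , y) ∈ graphEdges G₀ → (τ t x , τ t y) ∈ graphEdges (factor t)
  translate∈factor t xy∈ = subst ((τ t _ , τ t _) ∈_) (sym (graphEdges-map (τ t) G₀)) (∈-map⁺ (Product.map (τ t) (τ t)) xy∈)

  Covered : Vertex → Vertex → Set
  Covered x y = (x , y) ∈ E ⊎ (y , x) ∈ E

  EvenTranslateOfPQ : V∞ m → V∞ m → Set
  EvenTranslateOfPQ x y = ∃[ t ] blockParity t ≡ 0 × x ≡ just (p ∙ t) × y ≡ just (q ∙ t)

  EvenTranslateOfPQ⇒matched : ∀ {x y} → EvenTranslateOfPQ (just x) (just y) → y ≡ Mℤ x
  EvenTranslateOfPQ⇒matched (t , even , refl , refl) = sym (Mℤ-translate t even)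

  shiftV-halfN² : ∀ t v → shiftV (t ∙ halfN) (shiftV halfN v) ≡ shiftV t v
  shiftV-halfN² t nothing  = refl
  shiftV-halfN² t (just x) = cong just (begin
    x ∙ halfN ∙ (t ∙ halfN)   ≡⟨ interchange x halfN t halfN ⟩
    x ∙ t ∙ (halfN ∙ halfN)   ≡⟨ cong (x ∙ t ∙_) halfN∙halfN≡ε ⟩
    x ∙ t ∙ ε                 ≡⟨ identityʳ (x ∙ t) ⟩
    x ∙ t                     ∎)

  record EvenLift (a b : V∞ m) (t : Fin m) : Set where
    field
      t′       : Fin m
      t′-even  : blockParity t′ ≡ 0
      a′ b′    : V∞ m
      adjacent : Adj F a′ b′
      a′≈a     : shiftV t′ a′ ≡ shiftV t a
      b′≈b     : shiftV t′ b′ ≡ shiftV t b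

  -- Since F + n = F, an edge translated by an odd t is also a translate by the even t + n.
  evenLift : ∀ {a b} → Adj F a b → ∀ t → EvenLift a b t
  evenLift {a} {b} ab t with blockParity≡0⊎1 t
  ... | inj₁ even = record
    { t′ = t ; t′-even = even ; a′ = a ; b′ = b ; adjacent = ab ; a′≈a = refl ; b′≈b = refl }
  ... | inj₂ odd = record
    { t′ = t ∙ halfN ; t′-even = blockParity≡1⇒∙oddMultiple≡0 halfN-odd t odd
    ; a′ = shiftV halfN a ; b′ = shiftV halfN b ; adjacent = F+n⊆F _ _ (Adj-map (shiftV halfN) {G = F} ab)
    ; a′≈a = shiftV-halfN² t a ; b′≈b = shiftV-halfN² t b }

  translate-covered : ∀ {a b x y} → Adj F a b → ∀ t → shiftV t a ≡ x → shiftV t b ≡ y →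
                      ¬ EvenTranslateOfPQ x y → ¬ EvenTranslateOfPQ y x → Covered (ι x) (ι y)
  translate-covered ab t refl refl ¬xy ¬yx = subst₂ Covered (cong ι a′≈a) (cong ι b′≈b) lifted
    where
    open EvenLift (evenLift ab t)
    edge∈E : ∀ {u v} → (u , v) ∈ graphEdges F → ¬ EvenTranslateOfPQ (shiftV t′ u) (shiftV t′ v) →
             (ι (shiftV t′ u) , ι (shiftV t′ v)) ∈ E
    edge∈E {u} {v} uv∈ ¬del = subst₂ (λ x y → (x , y) ∈ E) (τ-ι t′ u) (τ-ι t′ v)
      (factor⊆E t′ t′-even (translate∈factor t′ (edge∈G₀ uv∈ uv≢pq)))
      where uv≢pq : (u , v) ≢ (just p , just q)
            uv≢pq refl = ¬del (t′ , t′-even , refl , refl)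
    lifted : Covered (ι (shiftV t′ a′)) (ι (shiftV t′ b′))
    lifted with adjacent
    ... | inj₁ a′b′∈ = inj₁ (edge∈E a′b′∈ (¬xy ∘′ subst₂ EvenTranslateOfPQ a′≈a b′≈b))
    ... | inj₂ b′a′∈ = inj₂ (edge∈E b′a′∈ (¬yx ∘′ subst₂ EvenTranslateOfPQ b′≈b a′≈a))

  covered-ℤℤ : ∀ z₁ z₂ → z₁ ≢ z₂ → z₂ ≢ Mℤ z₁ → Covered (ι (just z₁)) (ι (just z₂))
  covered-ℤℤ z₁ z₂ z₁≢z₂ z₂≢Mz₁ with ∈Δ⇒adjacent F (F-differences (z₁ - z₂) toℕ[z₁-z₂]≢0)
    where toℕ[z₁-z₂]≢0 : toℕ (z₁ - z₂) ≢ 0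
          toℕ[z₁-z₂]≢0 eq = z₁≢z₂ (x∙y⁻¹≈ε⇒x≈y z₁ z₂ (toℕ-injective {j = fzero} eq))
  ... | a , b , ab , a-b≡z₁-z₂ = translate-covered ab (z₂ - b)
    (cong just (begin
      a ∙ (z₂ - b)   ≡⟨ x∙[y-z]≈[x-z]∙y ℤₘ a z₂ b ⟩
      (a - b) ∙ z₂   ≡⟨ cong (_∙ z₂) a-b≡z₁-z₂ ⟩
      (z₁ - z₂) ∙ z₂ ≡⟨ //-rightDividesˡ z₂ z₁ ⟩
      z₁             ∎))
    (cong just (x∙[y-x]≈y ℤₘ b z₂))
    (λ del → z₂≢Mz₁ (EvenTranslateOfPQ⇒matched del))
    (λ del → z₂≢Mz₁ (trans (sym (Mℤ-involutive z₂)) (cong Mℤ (sym (EvenTranslateOfPQ⇒matched del)))))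

  covered-∞ℤ : ∀ z → Covered (ι nothing) (ι (just z))
  covered-∞ℤ z with ∃successor≢ ≟∞ F-regular count-∞
    where
    ≟∞ = Maybe.≡-dec _≟_
    count-∞ : Multiplicity.count ≟∞ nothing (allV∞ m) ≡ 1
    count-∞ = cong₂ _+_ (Multiplicity.[x≡?x]≡1 ≟∞ nothing) (count-map-∉ _≟_ ≟∞ just nothing (λ _ ()) (allFin m))
  ... | nothing , ∞≢∞ , _  = ⊥-elim (∞≢∞ refl)
  ... | just w  , _   , ∞w∈ = translate-covered (inj₁ ∞w∈) (z - w) refl (cong just (x∙[y-x]≈y ℤₘ w z))
    (λ { (_ , _ , () , _) }) (λ { (_ , _ , _ , ()) })

  covered-∞′ℤ : ∀ z → Covered ∞′ (ι (just z))
  covered-∞′ℤ z with blockParity≡0⊎1 (z - p)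
  ... | inj₁ even = inj₂ (subst (λ w → (ι (just w) , ∞′) ∈ E) (x∙[y-x]≈y ℤₘ p z)
                      (factor⊆E (z - p) even (translate∈factor (z - p) p∞′∈G₀)))
  ... | inj₂ odd  = inj₁ (subst (λ w → (∞′ , ι (just w)) ∈ E) (x∙[y-x]≈y ℤₘ q z)
                      (factor⊆E (z - q) even′ (translate∈factor (z - q) ∞′q∈G₀)))
    where even′ : blockParity (z - q) ≡ 0
          even′ = ∙oddMultiple≡1⇒blockParity≡0 q-p-odd (z - q) (trans (cong blockParity ([x-y]∙[y-z]≈x-z ℤₘ z q p)) odd)

  covered : ∀ x y → CompleteMinus M x y → Covered x y
  covered fzero            fzero            (x≢y , _)    = ⊥-elim (x≢y refl)
  covered fzero            (fsuc fzero)     (_ , y≢Mx)   = ⊥-elim (y≢Mx refl)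
  covered fzero            (fsuc (fsuc z))  _            = covered-∞′ℤ z
  covered (fsuc fzero)     fzero            (_ , y≢Mx)   = ⊥-elim (y≢Mx refl)
  covered (fsuc fzero)     (fsuc fzero)     (x≢y , _)    = ⊥-elim (x≢y refl)
  covered (fsuc fzero)     (fsuc (fsuc z))  _            = covered-∞ℤ z
  covered (fsuc (fsuc z))  fzero            _            = Sum.swap (covered-∞′ℤ z)
  covered (fsuc (fsuc z))  (fsuc fzero)     _            = Sum.swap (covered-∞ℤ z)
  covered (fsuc (fsuc z₁)) (fsuc (fsuc z₂)) (x≢y , y≢Mx) =
    covered-ℤℤ z₁ z₂ (x≢y ∘′ cong (λ w → fsuc (fsuc w))) (y≢Mx ∘′ cong (λ w → fsuc (fsuc w)))

  allFin-Vertex : ∞′ ∷ map ι (allV∞ m) ≡ allFin (2 + m)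
  allFin-Vertex = begin
    ∞′ ∷ fsuc fzero ∷ map ι (map just (allFin m))           ≡⟨ cong (λ zs → ∞′ ∷ fsuc fzero ∷ zs) (map-∘ (allFin m)) ⟨
    ∞′ ∷ fsuc fzero ∷ map (fsuc ∘′ fsuc) (allFin m)          ≡⟨ cong (λ zs → ∞′ ∷ fsuc fzero ∷ zs) (map-∘ (allFin m)) ⟩
    ∞′ ∷ fsuc fzero ∷ map fsuc (map fsuc (allFin m))         ≡⟨ cong (λ zs → ∞′ ∷ map fsuc zs) (allFin-suc m) ⟨
    ∞′ ∷ map fsuc (allFin (suc m))                          ≡⟨ allFin-suc (suc m) ⟨
    allFin (2 + m)                                          ∎

  concat-G₀↭ : concat G₀ ↭ allFin (2 + m)
  concat-G₀↭ =
    ↭-trans (++⁺ʳ (concat F̂s) Ĉ↭)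
   (↭-trans (↭-reflexive (cong (∞′ ∷_) (concat-map F)))
   (↭-trans (prep ∞′ (map⁺ ι (proj₂ F-regular)))
            (↭-reflexive allFin-Vertex)))

  concat-factor↭ : ∀ t → concat (factor t) ↭ allFin (2 + m)
  concat-factor↭ t =
    ↭-trans (↭-reflexive (concat-map G₀))
   (↭-trans (map⁺ (τ t) concat-G₀↭)
            (map-allFin-↭ (τ t) (τ (t ⁻¹)) (τ∘τ⁻¹ t) (τ⁻¹∘τ t)))

  L : List ℕ
  L = suc (length C) ∷ map length Fs

  map-length-factor : ∀ t → map length (factor t) ≡ L
  map-length-factor t = begin
    map length (map (map (τ t)) G₀)     ≡⟨ map-length-map-map (τ t) G₀ ⟩
    length Ĉ ∷ map length F̂s            ≡⟨ cong₂ _∷_ (trans (↭-length Ĉ↭) (cong suc (length-map ι C))) (map-length-map-map ι Fs) ⟩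
    L                                   ∎

  factor-isTwoFactor : ∀ t → IsTwoFactorOfType (2 + m) L (factor t)
  factor-isTwoFactor t = (lengths≥3 , concat-factor↭ t) , ↭-reflexive (map-length-factor t)
    where
    L≥3 : All (3 ≤_) L
    L≥3 = ≤-trans (All.head (proj₁ F-regular)) (n≤1+n _) ∷ All.map⁺ (All.tail (proj₁ F-regular))
    lengths≥3 : All (λ c → 3 ≤ length c) (factor t)
    lengths≥3 = All.map⁻ (subst (All (3 ≤_)) (sym (map-length-factor t)) L≥3)

  length-factors : length factors ≡ n
  length-factors = trans (length-map _ (allFin n)) (length-tabulate (λ i → i))

  solution : OPSolutionOfOrder (2 + m) L
  solution =
      CompleteMinus M
    , inj₂ (even-order , M , (M-fixedPointFree , M-involutive) , λ _ _ → (λ x → x) , (λ x → x))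
    , factors
    , All.map⁺ (All.tabulate (λ {i} _ → factor-isTwoFactor (representative i)))
    , All.tabulate (λ {e} → ∈⇒CompleteMinus)
    , occ+occ≡1
    where
    even-order : (2 + m) % 2 ≡ 0
    even-order = trans (cong (λ k → (2 + k) % 2) (*-comm 2 n)) (m*n%n≡0 (suc n) 2)
    open DoubleCounting M M-fixedPointFree factors
      (All.map⁺ (All.tabulate (λ {i} _ → concat-factor↭ (representative i))))
      (trans (cong (λ k → 2 + (n + k)) (+-identityʳ n)) (cong (λ k → 2 + (k + k)) (sym length-factors)))
      covered

sum-map-length : ∀ {A : Set} (G : List (List A)) → sum (map length G) ≡ length (concat G)
sum-map-length []      = refl
sum-map-length (c ∷ G) = trans (cong (length c +_) (sum-map-length G)) (sym (length-++ c))

order-after-insertion : ∀ {m} {C : List (V∞ m)} {Fs} → IsTwoRegularOn (allV∞ m) (C ∷ Fs) →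
                        2 + m ≡ sum (suc (length C) ∷ map length Fs)
order-after-insertion {m} {C} {Fs} (_ , concat↭allV∞) = cong suc (sym (begin
  sum (map length (C ∷ Fs))     ≡⟨ sum-map-length (C ∷ Fs) ⟩
  length (concat (C ∷ Fs))      ≡⟨ ↭-length concat↭allV∞ ⟩
  suc (length (map just (allFin m))) ≡⟨ cong suc (length-map just (allFin m)) ⟩
  suc (length (allFin m))       ≡⟨ cong suc (length-tabulate (λ i → i)) ⟩
  suc m                         ∎))

proposition2 : (n : ℕ) → (n≥1 : 1 ≤ n) →
    (C : List (V∞ (2 * n))) (Fs : List (List (V∞ (2 * n)))) →
    IsTwoRegularOn (allV∞ (2 * n)) (C ∷ Fs) →
    (∀ (d : Fin (2 * n)) → toℕ d ≢ 0 → d ∈ Δ (C ∷ Fs)) →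
    (∀ x y → (Adj (translate (C ∷ Fs) (halfElem n n≥1)) x y → Adj (C ∷ Fs) x y)
           × (Adj (C ∷ Fs) x y → Adj (translate (C ∷ Fs) (halfElem n n≥1)) x y)) →
    (∃[ d ] d ∈ Δ (C ∷ []) × ∃[ k ] IsAddOrder (2 * n) d k × k % 4 ≡ 2) →
    OP (suc (length C) ∷ map length Fs)
proposition2 (suc n′) (s≤s z≤n) C Fs F-regular F-differences F+n≡F (d , d∈ΔC , k , order , k%4≡2)
  with m%4≡2⇒m≡2*odd k k%4≡2
... | h , refl , h-odd with addOrder≡2h⇒oddMultiple {h = h} order
... | g , modulus≡2hg , d-odd with ∈Δ⇒edge (cycleEdges C ++ []) d∈ΔC
... | p , q , pq∈C++[] , p-q≡d⊎q-p≡d =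
  subst (λ v → OPSolutionOfOrder v (suc (length C) ∷ map length Fs)) (order-after-insertion F-regular)
    (Construction.solution n′ C Fs F-regular F-differences (λ x y → proj₁ (F+n≡F x y))
       p q (subst ((just p , just q) ∈_) (++-identityʳ (cycleEdges C)) pq∈C++[])
       h g modulus≡2hg h-odd (BlockParity.oddMultiple-reorient h g modulus≡2hg p q p-q≡d⊎q-p≡d d-odd))
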